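{- Let $s\ge3$ be an integer and $A_s=\begin{pmatrix}0&1&s-1&s\\1&1&1&1\end{pmatrix}$. Then the elements $(1,-1,-1,1)$, $(2-s,s-1,-1,0)$ and $(0,-1,s-1,2-s)$ of $\operatorname{Ker}_{\mathbb{Z}}(A_s)$ are indispensable.
   Context: For an integer matrix $M$ with $N$ columns, a Markov basis of $M$ is a finite set $\mathcal{M}\subseteq\operatorname{Ker}_{\mathbb{Z}}(M)$ such that whenever $\mathbf{w},\mathbf{u}\in\mathbb{N}^N$ with $\mathbf{w}-\mathbf{u}\in\operatorname{Ker}_{\mathbb{Z}}(M)$, there exist $\mathbf{v}_1,\ldots,\mathbf{v}_p\in\mathcal{M}\cup(-\mathcal{M})$ with $\mathbf{w}-\sum_{i=1}^l\mathbf{v}_i\in\mathbb{N}^N$ for all $1\le l\le p$ and $\mathbf{w}-\mathbf{u}=\sum_{i=1}^p\mathbf{v}_i$; it is minimal if no proper subset is a Markov basis. An element of $\operatorname{Ker}_{\mathbb{Z}}(M)$ is indispensable if it (up to sign) belongs to every minimal Markov basis of $M$. -}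

module Defs where

open import Data.Nat using (ℕ)
open import Data.Integer as ℤ using (ℤ; +_; _-_; -_; 0ℤ) renaming (_+_ to _+ℤ_; _*_ to _*ℤ_; _≥_ to _≥ℤ_)
open import Data.Vec using (Vec; []; _∷_; map; zipWith; replicate; foldr)
open import Data.Vec.Relation.Unary.All as VAll using ()
open import Data.List using (List; []; _∷_)
open import Data.List.Relation.Unary.All using (All)
open import Data.List.Relation.Unary.Any using (Any)
open import Data.List.Membership.Propositional using (_∈_; _∉_)
open import Data.Product using (Σ; _×_; ∃; ∃-syntax)
open import Data.Sum using (_⊎_)
open import Data.Unit using (⊤)
open import Relation.Nullary using (¬_)
open import Relation.Binary.PropositionalEquality using (_≡_)

ZVec : ℕ → Set
ZVec N = Vec ℤ N

Matrix : ℕ → ℕ → Set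
Matrix m N = Vec (ZVec N) m

_⊕_ : ∀ {N} → ZVec N → ZVec N → ZVec N
_⊕_ = zipWith _+ℤ_

_⊖_ : ∀ {N} → ZVec N → ZVec N → ZVec N
_⊖_ = zipWith _-_

neg : ∀ {N} → ZVec N → ZVec N
neg = map (λ x → - x)

zero-vec : ∀ {N} → ZVec N
zero-vec = replicate _ 0ℤ

dot : ∀ {N} → ZVec N → ZVec N → ℤ
dot u v = foldr _ _+ℤ_ 0ℤ (zipWith _*ℤ_ u v)

ι : ∀ {N} → Vec ℕ N → ZVec N
ι = map +_

InKer : ∀ {m N} → Matrix m N → ZVec N → Set
InKer M v = VAll.All (λ row → dot row v ≡ 0ℤ) M

NonNeg : ∀ {N} → ZVec N → Set
NonNeg v = VAll.All (λ x → x ≥ℤ 0ℤ) v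

vsum : ∀ {N} → List (ZVec N) → ZVec N
vsum []       = zero-vec
vsum (v ∷ vs) = v ⊕ vsum vs

-- Steps w [v₁,…,vₚ] : w - Σ_{i≤l} vᵢ ∈ ℕ^N for all 1 ≤ l ≤ p
Steps : ∀ {N} → ZVec N → List (ZVec N) → Set
Steps w []       = ⊤
Steps w (v ∷ vs) = NonNeg (w ⊖ v) × Steps (w ⊖ v) vs

_∈±_ : ∀ {N} → ZVec N → List (ZVec N) → Set
v ∈± 𝓜 = v ∈ 𝓜 ⊎ neg v ∈ 𝓜

-- Markov basis of M: a finite set 𝓜 (given as a list) ⊆ Ker_ℤ(M) such that
-- any w, u ∈ ℕ^N with w - u ∈ Ker_ℤ(M) are connected by moves from 𝓜 ∪ (-𝓜)
-- staying in ℕ^N.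
MarkovBasis : ∀ {m N} → Matrix m N → List (ZVec N) → Set
MarkovBasis {N = N} M 𝓜 =
  All (InKer M) 𝓜 ×
  ((w u : Vec ℕ N) → InKer M (ι w ⊖ ι u) →
     ∃[ vs ] (All (_∈± 𝓜) vs × Steps (ι w) vs × (ι w ⊖ ι u ≡ vsum vs)))

ProperSubset : ∀ {N} → List (ZVec N) → List (ZVec N) → Set
ProperSubset 𝓜' 𝓜 = All (_∈ 𝓜) 𝓜' × ∃[ x ] (x ∈ 𝓜 × x ∉ 𝓜')

MinimalMarkovBasis : ∀ {m N} → Matrix m N → List (ZVec N) → Set
MinimalMarkovBasis M 𝓜 =
  MarkovBasis M 𝓜 × (∀ 𝓜' → ProperSubset 𝓜' 𝓜 → ¬ MarkovBasis M 𝓜')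

Indispensable : ∀ {m N} → Matrix m N → ZVec N → Set
Indispensable M v =
  InKer M v × (∀ 𝓜 → MinimalMarkovBasis M 𝓜 → v ∈± 𝓜)

A : ℕ → Matrix 2 4
A s = (+ 0 ∷ + 1 ∷ (+ s - + 1) ∷ + s ∷ [])
    ∷ (+ 1 ∷ + 1 ∷ + 1 ∷ + 1 ∷ [])
    ∷ []

-- If w and u are the only points q ∈ ℕᴺ with A q = A u, then ±(w − u) lies in every Markov basis:
-- a path of moves from w to u never leaves this fibre, so its first step away from w lands on u
-- and is the move w − u itself.
-- For A_s and t = s − 1, A q records the weight b + t c + s d and the degree a + b + c + d of
-- q = (a, b, c, d). Bounding c and d through the weight shows that the fibres of the three moves
-- are {(1,0,0,1), (0,1,1,0)}, {(0,t,0,0), (t−1,0,1,0)} and {(0,0,t,0), (0,1,0,t−1)}. The third is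
-- the mirror image of the second: reversing coordinates keeps the degree and turns the weight
-- into s · degree − weight.
module Submission where

open import Defs
open import Data.Nat using (ℕ; suc; _+_; _*_; _≥_; s≤s)
open import Data.Nat.Properties using (m≢1+n+m; suc-injective; +-identityʳ; +-cancelˡ-≡; +-cancelʳ-≡)
open import Data.Nat.Tactic.RingSolver using (solve)
open import Data.Integer as ℤ using (+_; -_; _-_; 0ℤ; -[1+_]) renaming (_+_ to _+ℤ_; _*_ to _*ℤ_)
import Data.Integer.Properties as ℤ
import Data.Integer.Tactic.RingSolver as ℤ-Solver
open import Data.Vec using (Vec; []; _∷_; map; reverse; toList)
open import Data.Vec.Properties using (∷-injective; reverse-involutive)
import Data.Vec.Relation.Unary.All as VAll
open import Data.List.Relation.Unary.All as All using (All)
open import Data.List.Relation.Unary.Any using (here; there)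
open import Data.List.Membership.Propositional using (_∈_)
open import Data.Product using (_×_; _,_; proj₁; ∃-syntax)
open import Data.Sum using (_⊎_; inj₁; inj₂)
open import Data.Sum.Function.Propositional using (_⊎-⇔_)
open import Data.Empty using (⊥-elim)
open import Function using (_∘_)
open import Function.Bundles using (_⇔_; mk⇔; Equivalence)
open import Function.Construct.Composition using (_⇔-∘_)
open import Relation.Binary.PropositionalEquality
open ≡-Reasoning

dot-⊖ : ∀ {N} (r x y : ZVec N) → dot r (x ⊖ y) ≡ dot r x - dot r y
dot-⊖ []      []       []       = refl
dot-⊖ (a ∷ r) (x ∷ xs) (y ∷ ys) =
  trans (cong (a *ℤ (x - y) +ℤ_) (dot-⊖ r xs ys)) (distrib a x y (dot r xs) (dot r ys))
  where
  distrib : ∀ a x y p q → a *ℤ (x - y) +ℤ (p - q) ≡ (a *ℤ x +ℤ p) - (a *ℤ y +ℤ q)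
  distrib = ℤ-Solver.solve-∀

dot-neg : ∀ {N} (r x : ZVec N) → dot r (neg x) ≡ - dot r x
dot-neg []      []       = refl
dot-neg (a ∷ r) (x ∷ xs) =
  trans (cong (a *ℤ (- x) +ℤ_) (dot-neg r xs)) (distrib a x (dot r xs))
  where
  distrib : ∀ a x p → a *ℤ (- x) +ℤ (- p) ≡ - (a *ℤ x +ℤ p)
  distrib = ℤ-Solver.solve-∀

InKer-⊖ : ∀ {m N} {M : Matrix m N} {x y} → InKer M x → InKer M y → InKer M (x ⊖ y)
InKer-⊖ {x = x} {y} Mx My =
  VAll.map (λ {r} (rx , ry) → trans (dot-⊖ r x y) (cong₂ _-_ rx ry)) (VAll.zip (Mx , My))

InKer-neg⁻ : ∀ {m N} {M : Matrix m N} {x} → InKer M (neg x) → InKer M x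
InKer-neg⁻ {x = x} = VAll.map (λ {r} r-x → ℤ.neg-injective (trans (sym (dot-neg r x)) r-x))

∈±⇒InKer : ∀ {m N} {M : Matrix m N} {𝓜 v} → All (InKer M) 𝓜 → v ∈± 𝓜 → InKer M v
∈±⇒InKer 𝓜⊆Ker (inj₁ v∈𝓜)  = All.lookup 𝓜⊆Ker v∈𝓜
∈±⇒InKer 𝓜⊆Ker (inj₂ -v∈𝓜) = InKer-neg⁻ (All.lookup 𝓜⊆Ker -v∈𝓜)

[x⊖y]⊖z≡[x⊖z]⊖y : ∀ {N} (x y z : ZVec N) → (x ⊖ y) ⊖ z ≡ (x ⊖ z) ⊖ y
[x⊖y]⊖z≡[x⊖z]⊖y []       []       []       = refl
[x⊖y]⊖z≡[x⊖z]⊖y (x ∷ xs) (y ∷ ys) (z ∷ zs) =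
  cong₂ _∷_ (swap x y z) ([x⊖y]⊖z≡[x⊖z]⊖y xs ys zs)
  where
  swap : ∀ x y z → (x - y) - z ≡ (x - z) - y
  swap = ℤ-Solver.solve-∀

[x⊕y]⊖x≡y : ∀ {N} (x y : ZVec N) → (x ⊕ y) ⊖ x ≡ y
[x⊕y]⊖x≡y []       []       = refl
[x⊕y]⊖x≡y (x ∷ xs) (y ∷ ys) = cong₂ _∷_ (cancel x y) ([x⊕y]⊖x≡y xs ys)
  where
  cancel : ∀ x y → (x +ℤ y) - x ≡ y
  cancel = ℤ-Solver.solve-∀

x⊖[x⊖y]≡y : ∀ {N} (x y : ZVec N) → x ⊖ (x ⊖ y) ≡ y
x⊖[x⊖y]≡y []       []       = refl
x⊖[x⊖y]≡y (x ∷ xs) (y ∷ ys) = cong₂ _∷_ (cancel x y) (x⊖[x⊖y]≡y xs ys)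
  where
  cancel : ∀ x y → x - (x - y) ≡ y
  cancel = ℤ-Solver.solve-∀

nonNeg⇒ι : ∀ {N} {p : ZVec N} → NonNeg p → ∃[ q ] p ≡ ι q
nonNeg⇒ι {p = p} p≥0 = map ℤ.∣_∣ p , sym (ι∣p∣≡p p p≥0)
  where
  ι∣p∣≡p : ∀ {N} (p : ZVec N) → NonNeg p → ι (map ℤ.∣_∣ p) ≡ p
  ι∣p∣≡p []      _     = refl
  ι∣p∣≡p (x ∷ p) x∷p≥0 = cong₂ _∷_ (ℤ.0≤i⇒+∣i∣≡i (VAll.head x∷p≥0)) (ι∣p∣≡p p (VAll.tail x∷p≥0))

ι⊖ι≡zero⇒≡ : ∀ {N} {x y : Vec ℕ N} → ι x ⊖ ι y ≡ zero-vec → x ≡ y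
ι⊖ι≡zero⇒≡ {x = []}     {[]}     _ = refl
ι⊖ι≡zero⇒≡ {x = x ∷ _} {y ∷ _} e with ∷-injective e
... | x-y≡0 , rest = cong₂ _∷_ (ℤ.+-injective (ℤ.i-j≡0⇒i≡j (+ x) (+ y) x-y≡0)) (ι⊖ι≡zero⇒≡ rest)

module _ {m N} (M : Matrix m N) {w u : Vec ℕ N} (w≢u : w ≢ u)
         (fibre : ∀ q → InKer M (ι q ⊖ ι u) ⇔ (q ≡ w ⊎ q ≡ u)) where

  open import Data.List using ([]; _∷_)
  open import Data.List.Relation.Unary.All using ([]; _∷_)

  private
    w⊖u∈Ker : InKer M (ι w ⊖ ι u)
    w⊖u∈Ker = Equivalence.from (fibre w) (inj₁ refl)

    move-stays-in-fibre : ∀ {v} → InKer M v → InKer M ((ι w ⊖ v) ⊖ ι u)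
    move-stays-in-fibre v∈Ker =
      subst (InKer M) ([x⊖y]⊖z≡[x⊖z]⊖y (ι w) (ι u) _) (InKer-⊖ w⊖u∈Ker v∈Ker)

    w⊖u∈path : ∀ vs → All (InKer M) vs → Steps (ι w) vs → ι w ⊖ ι u ≡ vsum vs → ι w ⊖ ι u ∈ vs
    w⊖u∈path []       _                _                w⊖u≡0 = ⊥-elim (w≢u (ι⊖ι≡zero⇒≡ w⊖u≡0))
    w⊖u∈path (v ∷ vs) (v∈Ker ∷ vs⊆Ker) (w⊖v≥0 , steps) w⊖u≡v⊕vs with nonNeg⇒ι w⊖v≥0
    ... | q , w⊖v≡q
      with Equivalence.to (fibre q) (subst (λ p → InKer M (p ⊖ ι u)) w⊖v≡q (move-stays-in-fibre v∈Ker))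
    ... | inj₂ refl = here (trans (cong (ι w ⊖_) (sym w⊖v≡q)) (x⊖[x⊖y]≡y (ι w) v))
    ... | inj₁ refl = there (w⊖u∈path vs vs⊆Ker (subst (λ p → Steps p vs) w⊖v≡q steps) (begin
      ι w ⊖ ι u                ≡⟨ cong (_⊖ ι u) (sym w⊖v≡q) ⟩
      (ι w ⊖ v) ⊖ ι u          ≡⟨ [x⊖y]⊖z≡[x⊖z]⊖y (ι w) v (ι u) ⟩
      (ι w ⊖ ι u) ⊖ v          ≡⟨ cong (_⊖ v) w⊖u≡v⊕vs ⟩
      (v ⊕ vsum vs) ⊖ v        ≡⟨ [x⊕y]⊖x≡y v (vsum vs) ⟩
      vsum vs                  ∎))

  w⊖u∈±MarkovBasis : ∀ 𝓜 → MarkovBasis M 𝓜 → (ι w ⊖ ι u) ∈± 𝓜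
  w⊖u∈±MarkovBasis 𝓜 (𝓜⊆Ker , connected) with connected w u w⊖u∈Ker
  ... | vs , vs⊆±𝓜 , steps , w⊖u≡vs =
    All.lookup vs⊆±𝓜 (w⊖u∈path vs (All.map (∈±⇒InKer 𝓜⊆Ker) vs⊆±𝓜) steps w⊖u≡vs)

  fibre-pair⇒indispensable : Indispensable M (ι w ⊖ ι u)
  fibre-pair⇒indispensable = w⊖u∈Ker , λ 𝓜 → w⊖u∈±MarkovBasis 𝓜 ∘ proj₁

dotℕ : ∀ {N} → Vec ℕ N → Vec ℕ N → ℕ
dotℕ []      []       = 0
dotℕ (a ∷ r) (x ∷ xs) = a * x + dotℕ r xs

dot-ι : ∀ {N} (r x : Vec ℕ N) → dot (ι r) (ι x) ≡ + dotℕ r x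
dot-ι []      []       = refl
dot-ι (a ∷ r) (x ∷ xs) = cong₂ _+ℤ_ (sym (ℤ.pos-* a x)) (dot-ι r xs)

dot-ι⊖ι≡0⇔ : ∀ {N} (r : ZVec N) (f : Vec ℕ N → ℕ) → (∀ x → dot r (ι x) ≡ + f x) →
             ∀ x y → dot r (ι x ⊖ ι y) ≡ 0ℤ ⇔ f x ≡ f y
dot-ι⊖ι≡0⇔ r f r·ι≡f x y = mk⇔
  (λ e → ℤ.+-injective (ℤ.i-j≡0⇒i≡j _ _ (trans (sym r·[x⊖y]) e)))
  (λ e → trans r·[x⊖y] (trans (cong (λ n → + n - + f y) e) (ℤ.+-inverseʳ (+ f y))))
  where
  r·[x⊖y] : dot r (ι x ⊖ ι y) ≡ + f x - + f y
  r·[x⊖y] = trans (dot-⊖ r (ι x) (ι y)) (cong₂ _-_ (r·ι≡f x) (r·ι≡f y))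

weight : ℕ → Vec ℕ 4 → ℕ
weight t (a ∷ b ∷ c ∷ d ∷ []) = b + c * t + d * suc t

degree : Vec ℕ 4 → ℕ
degree (a ∷ b ∷ c ∷ d ∷ []) = a + b + c + d

-- A (suc t) reduces to ι (A-row₁ t) ∷ ι A-row₂ ∷ []: its entry + suc t - + 1 computes to + t.
A-row₁ : ℕ → Vec ℕ 4
A-row₁ t = 0 ∷ 1 ∷ t ∷ suc t ∷ []

A-row₂ : Vec ℕ 4
A-row₂ = 1 ∷ 1 ∷ 1 ∷ 1 ∷ []

-- The solver's variables are passed as a vector through toList, as only the vector constructors
-- are in scope here.
A-row₁·≡weight : ∀ t x → dot (ι (A-row₁ t)) (ι x) ≡ + weight t x
A-row₁·≡weight t x@(a ∷ b ∷ c ∷ d ∷ []) = trans (dot-ι (A-row₁ t) x) (cong +_ (begin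
  0 * a + (1 * b + (t * c + (suc t * d + 0))) ≡⟨ solve (toList (t ∷ a ∷ b ∷ c ∷ d ∷ [])) ⟩
  b + c * t + d * suc t                       ∎))

A-row₂·≡degree : ∀ x → dot (ι A-row₂) (ι x) ≡ + degree x
A-row₂·≡degree x@(a ∷ b ∷ c ∷ d ∷ []) = trans (dot-ι A-row₂ x) (cong +_ (begin
  1 * a + (1 * b + (1 * c + (1 * d + 0))) ≡⟨ solve (toList (a ∷ b ∷ c ∷ d ∷ [])) ⟩
  a + b + c + d                           ∎))

A-kernel⇔ : ∀ t q u →
            InKer (A (suc t)) (ι q ⊖ ι u) ⇔ (weight t q ≡ weight t u × degree q ≡ degree u)
A-kernel⇔ t q u = mk⇔
  (λ ker → Equivalence.to same-weight (VAll.head ker)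
         , Equivalence.to same-degree (VAll.head (VAll.tail ker)))
  (λ (W , D) → Equivalence.from same-weight W VAll.∷ Equivalence.from same-degree D VAll.∷ VAll.[])
  where
  same-weight = dot-ι⊖ι≡0⇔ (ι (A-row₁ t)) (weight t) (A-row₁·≡weight t) q u
  same-degree = dot-ι⊖ι≡0⇔ (ι A-row₂) degree A-row₂·≡degree q u

fibre-pair⇒indispensable-A : ∀ t {w u : Vec ℕ 4} {m n} → w ≢ u →
  (∀ q → (weight t q ≡ m × degree q ≡ n) ⇔ (q ≡ w ⊎ q ≡ u)) → Indispensable (A (suc t)) (ι w ⊖ ι u)
fibre-pair⇒indispensable-A t {w} {u} w≢u fibre with Equivalence.from (fibre u) (inj₂ refl)
... | refl , refl = fibre-pair⇒indispensable (A (suc t)) w≢u (λ q → fibre q ⇔-∘ A-kernel⇔ t q u)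

overshoot : ∀ {m n} e → n ≡ m → n ≢ suc (e + m)
overshoot {m} e n≡m n≡1+e+m = m≢1+n+m m (trans (sym n≡m) n≡1+e+m)

fibre₁⊆ : ∀ k a b c d → b + c * (2 + k) + d * (3 + k) ≡ 3 + k → a + b + c + d ≡ 2 →
          a ∷ b ∷ c ∷ d ∷ [] ≡ 1 ∷ 0 ∷ 0 ∷ 1 ∷ [] ⊎ a ∷ b ∷ c ∷ d ∷ [] ≡ 0 ∷ 1 ∷ 1 ∷ 0 ∷ []
fibre₁⊆ k a b c (suc (suc d)) W _ =
  ⊥-elim (overshoot (b + c * (2 + k) + d * (3 + k) + (2 + k)) W (solve (toList (k ∷ b ∷ c ∷ d ∷ []))))
fibre₁⊆ k a b (suc c) 1 W _ =
  ⊥-elim (overshoot (b + c * (2 + k) + (1 + k)) W (solve (toList (k ∷ b ∷ c ∷ []))))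
fibre₁⊆ k a (suc b) 0 1 W _ = ⊥-elim (overshoot b W (solve (toList (k ∷ b ∷ []))))
fibre₁⊆ k 0 0 0 1 _ ()
fibre₁⊆ k 1 0 0 1 _ _ = inj₁ refl
fibre₁⊆ k (suc (suc a)) 0 0 1 _ D = ⊥-elim (overshoot a D (solve (toList (a ∷ []))))
fibre₁⊆ k a b (suc (suc c)) 0 W _ =
  ⊥-elim (overshoot (b + c * (2 + k) + k) W (solve (toList (k ∷ b ∷ c ∷ []))))
fibre₁⊆ k a (suc (suc b)) 1 0 W _ = ⊥-elim (overshoot b W (solve (toList (k ∷ b ∷ []))))
fibre₁⊆ k a 0 1 0 W _ = ⊥-elim (overshoot 0 (sym W) (solve (toList (k ∷ []))))
fibre₁⊆ k 0 1 1 0 _ _ = inj₂ refl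
fibre₁⊆ k (suc a) 1 1 0 _ D = ⊥-elim (overshoot a D (solve (toList (a ∷ []))))
fibre₁⊆ k a b 0 0 W D = ⊥-elim (overshoot (a + k) D (begin
  a + b + 0 + 0     ≡⟨ solve (toList (a ∷ b ∷ [])) ⟩
  a + (b + 0 + 0)   ≡⟨ cong (λ x → a + x) W ⟩
  a + (3 + k)       ≡⟨ solve (toList (a ∷ k ∷ [])) ⟩
  suc (a + k + 2)   ∎))

fibre₁ : ∀ k q → (weight (2 + k) q ≡ 3 + k × degree q ≡ 2)
                 ⇔ (q ≡ 1 ∷ 0 ∷ 0 ∷ 1 ∷ [] ⊎ q ≡ 0 ∷ 1 ∷ 1 ∷ 0 ∷ [])
fibre₁ k (a ∷ b ∷ c ∷ d ∷ []) = mk⇔ (λ (W , D) → fibre₁⊆ k a b c d W D) λ where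
  (inj₁ refl) → (begin 0 + 0 * (2 + k) + 1 * (3 + k) ≡⟨ solve (toList (k ∷ [])) ⟩ 3 + k ∎) , refl
  (inj₂ refl) → (begin 1 + 1 * (2 + k) + 0 * (3 + k) ≡⟨ solve (toList (k ∷ [])) ⟩ 3 + k ∎) , refl

fibre₂⊆ : ∀ r a b c d → b + c * (1 + r) + d * (2 + r) ≡ 1 + r → a + b + c + d ≡ 1 + r →
          a ∷ b ∷ c ∷ d ∷ [] ≡ 0 ∷ 1 + r ∷ 0 ∷ 0 ∷ [] ⊎ a ∷ b ∷ c ∷ d ∷ [] ≡ r ∷ 0 ∷ 1 ∷ 0 ∷ []
fibre₂⊆ r a b c (suc d) W _ =
  ⊥-elim (overshoot (b + c * (1 + r) + d * (2 + r)) W (solve (toList (r ∷ b ∷ c ∷ d ∷ []))))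
fibre₂⊆ r a b (suc (suc c)) 0 W _ =
  ⊥-elim (overshoot (b + c * (1 + r) + r) W (solve (toList (r ∷ b ∷ c ∷ []))))
fibre₂⊆ r a (suc b) 1 0 W _ = ⊥-elim (overshoot b W (solve (toList (r ∷ b ∷ []))))
fibre₂⊆ r a 0 1 0 _ D = inj₂ (cong (λ x → x ∷ 0 ∷ 1 ∷ 0 ∷ []) (suc-injective (begin
  suc a         ≡⟨ solve (toList (a ∷ [])) ⟩
  a + 0 + 1 + 0 ≡⟨ D ⟩
  1 + r         ∎)))
fibre₂⊆ r a b 0 0 W D = inj₁ (cong₂ (λ x y → x ∷ y ∷ 0 ∷ 0 ∷ []) a≡0 b≡1+r)
  where
  b≡1+r : b ≡ 1 + r
  b≡1+r = begin b ≡⟨ solve (toList (b ∷ [])) ⟩ b + 0 + 0 ≡⟨ W ⟩ 1 + r ∎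
  a≡0 : a ≡ 0
  a≡0 = +-cancelʳ-≡ b a 0 (begin
    a + b         ≡⟨ solve (toList (a ∷ b ∷ [])) ⟩
    a + b + 0 + 0 ≡⟨ D ⟩
    1 + r         ≡⟨ sym b≡1+r ⟩
    b             ∎)

fibre₂ : ∀ r q → (weight (1 + r) q ≡ 1 + r × degree q ≡ 1 + r)
                 ⇔ (q ≡ 0 ∷ 1 + r ∷ 0 ∷ 0 ∷ [] ⊎ q ≡ r ∷ 0 ∷ 1 ∷ 0 ∷ [])
fibre₂ r (a ∷ b ∷ c ∷ d ∷ []) = mk⇔ (λ (W , D) → fibre₂⊆ r a b c d W D) λ where
  (inj₁ refl) → (begin (1 + r) + 0 * (1 + r) + 0 * (2 + r) ≡⟨ solve (toList (r ∷ [])) ⟩ 1 + r ∎)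
              , (begin 0 + (1 + r) + 0 + 0 ≡⟨ solve (toList (r ∷ [])) ⟩ 1 + r ∎)
  (inj₂ refl) → (begin 0 + 1 * (1 + r) + 0 * (2 + r) ≡⟨ solve (toList (r ∷ [])) ⟩ 1 + r ∎)
              , (begin r + 0 + 1 + 0 ≡⟨ solve (toList (r ∷ [])) ⟩ 1 + r ∎)

weight-reverse : ∀ t q → weight t (reverse q) + weight t q ≡ suc t * degree q
weight-reverse t (a ∷ b ∷ c ∷ d ∷ []) = begin
  (c + b * t + a * suc t) + (b + c * t + d * suc t) ≡⟨ solve (toList (t ∷ a ∷ b ∷ c ∷ d ∷ [])) ⟩
  suc t * (a + b + c + d)                           ∎

degree-reverse : ∀ q → degree (reverse q) ≡ degree q
degree-reverse (a ∷ b ∷ c ∷ d ∷ []) = begin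
  d + c + b + a ≡⟨ solve (toList (a ∷ b ∷ c ∷ d ∷ [])) ⟩
  a + b + c + d ∎

reverse-fibre : ∀ t q → (weight t q ≡ t * t × degree q ≡ t)
                        ⇔ (weight t (reverse q) ≡ t × degree (reverse q) ≡ t)
reverse-fibre t q = mk⇔
  (λ (W , D) → +-cancelʳ-≡ (weight t q) _ _ (trans (balance D) (cong (λ x → t + x) (sym W)))
             , trans (degree-reverse q) D)
  (λ (W , D) → let D′ = trans (sym (degree-reverse q)) D in
               +-cancelˡ-≡ t _ _ (trans (cong (_+ weight t q) (sym W)) (balance D′)) , D′)
  where
  balance : degree q ≡ t → weight t (reverse q) + weight t q ≡ t + t * t
  balance D = trans (weight-reverse t q) (cong (suc t *_) D)

reverse-≡⇔ : ∀ {n} (q v : Vec ℕ n) → reverse q ≡ v ⇔ q ≡ reverse v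
reverse-≡⇔ q v = mk⇔
  (λ e → trans (sym (reverse-involutive q)) (cong reverse e))
  (λ e → trans (cong reverse e) (reverse-involutive v))

fibre₃ : ∀ r q → (weight (1 + r) q ≡ (1 + r) * (1 + r) × degree q ≡ 1 + r)
                 ⇔ (q ≡ 0 ∷ 0 ∷ 1 + r ∷ 0 ∷ [] ⊎ q ≡ 0 ∷ 1 ∷ 0 ∷ r ∷ [])
fibre₃ r q =
  (reverse-≡⇔ q _ ⊎-⇔ reverse-≡⇔ q _) ⇔-∘ (fibre₂ r (reverse q) ⇔-∘ reverse-fibre (1 + r) q)

lemma4p1 : (s : ℕ) → s ≥ 3 →
    Indispensable (A s) (+ 1 ∷ - + 1 ∷ - + 1 ∷ + 1 ∷ [])
    × Indispensable (A s) ((+ 2 - + s) ∷ (+ s - + 1) ∷ - + 1 ∷ + 0 ∷ [])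
    × Indispensable (A s) (+ 0 ∷ - + 1 ∷ (+ s - + 1) ∷ (+ 2 - + s) ∷ [])
lemma4p1 (suc (suc (suc k))) (s≤s (s≤s (s≤s _))) =
    fibre-pair⇒indispensable-A (2 + k) (λ ()) (fibre₁ k)
  , subst (Indispensable (A s)) move₂ (fibre-pair⇒indispensable-A (2 + k) (λ ()) (fibre₂ (1 + k)))
  , subst (Indispensable (A s)) move₃ (fibre-pair⇒indispensable-A (2 + k) (λ ()) (fibre₃ (1 + k)))
  where
  s = 3 + k
  -- ι x ⊖ ι 0 computes the entry x as + (x + 0).
  move₂ : ι (0 ∷ 2 + k ∷ 0 ∷ 0 ∷ []) ⊖ ι (1 + k ∷ 0 ∷ 1 ∷ 0 ∷ [])
        ≡ (+ 2 - + s) ∷ (+ s - + 1) ∷ - + 1 ∷ + 0 ∷ []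
  move₂ = cong (λ n → -[1+ k ] ∷ + n ∷ - + 1 ∷ + 0 ∷ []) (+-identityʳ (2 + k))
  move₃ : ι (0 ∷ 0 ∷ 2 + k ∷ 0 ∷ []) ⊖ ι (0 ∷ 1 ∷ 0 ∷ 1 + k ∷ [])
        ≡ + 0 ∷ - + 1 ∷ (+ s - + 1) ∷ (+ 2 - + s) ∷ []
  move₃ = cong (λ n → + 0 ∷ - + 1 ∷ + n ∷ -[1+ k ] ∷ []) (+-identityʳ (2 + k))
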